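{- Let $L$ be a superintuitionistic logic. Then $L$ has at most one non-trivial apartness relation between propositions up to logical equivalence in $L$; moreover, any non-trivial apartness relation $P\#Q$ between propositions in $L$ satisfies $(P\#Q)\leftrightarrow\neg(P\leftrightarrow Q)\in L$.
   Context: Formulas are those of intuitionistic propositional logic IPC; $\neg\varphi$ abbreviates $\varphi\to\bot$ and $\varphi\leftrightarrow\psi$ abbreviates $(\varphi\to\psi)\wedge(\psi\to\varphi)$. A superintuitionistic logic is a set $L$ of formulas containing all IPC-theorems, closed under modus ponens, and closed under uniform substitution of formulas for proposition letters. Given a formula $P\#Q$ in two proposition letters $P,Q$, write $\varphi\#\psi$ for the result of substituting $\varphi$ for $P$ and $\psi$ for $Q$. $P\#Q$ is an apartness relation between propositions in $L$ if for all formulas $\varphi,\psi,\theta$: $\neg(\varphi\#\varphi)\in L$; $(\varphi\#\psi)\to(\psi\#\varphi)\in L$; $(\varphi\#\psi)\to((\varphi\#\theta)\vee(\theta\#\psi))\in L$. It is trivial if $\neg(P\#Q)\in L$, and non-trivial otherwise. -}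

module Defs where

open import Data.Nat using (ℕ; zero; suc)
open import Data.Empty renaming (⊥ to Empty)
open import Data.Product using (_×_)
open import Data.Sum using (_⊎_)
open import Relation.Binary.PropositionalEquality using (_≡_)

infixr 4 _⇒_
infix 3 _⇔ᶠ_
infix 7 ¬ᶠ_
infixr 5 _∨ᶠ_
infixr 6 _∧ᶠ_
data Formula : Set where
  var   : ℕ → Formula
  ⊥ᶠ    : Formula
  _∧ᶠ_  : Formula → Formula → Formula
  _∨ᶠ_  : Formula → Formula → Formula
  _⇒_   : Formula → Formula → Formula

¬ᶠ_ : Formula → Formula
¬ᶠ φ = φ ⇒ ⊥ᶠ

_⇔ᶠ_ : Formula → Formula → Formula
φ ⇔ᶠ ψ = (φ ⇒ ψ) ∧ᶠ (ψ ⇒ φ)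

subst : (ℕ → Formula) → Formula → Formula
subst σ (var n)  = σ n
subst σ ⊥ᶠ       = ⊥ᶠ
subst σ (φ ∧ᶠ ψ) = subst σ φ ∧ᶠ subst σ ψ
subst σ (φ ∨ᶠ ψ) = subst σ φ ∨ᶠ subst σ ψ
subst σ (φ ⇒ ψ)  = subst σ φ ⇒ subst σ ψ

data IPC : Formula → Set where
  ax-K   : ∀ A B → IPC (A ⇒ B ⇒ A)
  ax-S   : ∀ A B C → IPC ((A ⇒ B ⇒ C) ⇒ (A ⇒ B) ⇒ A ⇒ C)
  ax-∧₁  : ∀ A B → IPC (A ∧ᶠ B ⇒ A)
  ax-∧₂  : ∀ A B → IPC (A ∧ᶠ B ⇒ B)
  ax-∧i  : ∀ A B → IPC (A ⇒ B ⇒ A ∧ᶠ B)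
  ax-∨₁  : ∀ A B → IPC (A ⇒ A ∨ᶠ B)
  ax-∨₂  : ∀ A B → IPC (B ⇒ A ∨ᶠ B)
  ax-∨e  : ∀ A B C → IPC ((A ⇒ C) ⇒ (B ⇒ C) ⇒ A ∨ᶠ B ⇒ C)
  ax-⊥   : ∀ A → IPC (⊥ᶠ ⇒ A)
  mp     : ∀ {A B} → IPC (A ⇒ B) → IPC A → IPC B

record Superintuitionistic (L : Formula → Set) : Set where
  field
    ipc⊆   : ∀ {φ} → IPC φ → L φ
    mp-cl  : ∀ {φ ψ} → L (φ ⇒ ψ) → L φ → L ψ
    sub-cl : ∀ (σ : ℕ → Formula) {φ} → L φ → L (subst σ φ)

P Q : Formula
P = var 0
Q = var 1

data InPQ : Formula → Set where
  v-P : InPQ P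
  v-Q : InPQ Q
  c-⊥ : InPQ ⊥ᶠ
  c-∧ : ∀ {φ ψ} → InPQ φ → InPQ ψ → InPQ (φ ∧ᶠ ψ)
  c-∨ : ∀ {φ ψ} → InPQ φ → InPQ ψ → InPQ (φ ∨ᶠ ψ)
  c-⇒ : ∀ {φ ψ} → InPQ φ → InPQ ψ → InPQ (φ ⇒ ψ)

σ₂ : Formula → Formula → ℕ → Formula
σ₂ φ ψ zero          = φ
σ₂ φ ψ (suc zero)    = ψ
σ₂ φ ψ (suc (suc n)) = var (suc (suc n))

-- φ # ψ for a formula A = P # Q
inst : Formula → Formula → Formula → Formula
inst A φ ψ = subst (σ₂ φ ψ) A

record Apartness (L : Formula → Set) (A : Formula) : Set where
  field
    irrefl : ∀ φ → L (¬ᶠ inst A φ φ)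
    symm   : ∀ φ ψ → L (inst A φ ψ ⇒ inst A ψ φ)
    cotrans : ∀ φ ψ θ → L (inst A φ ψ ⇒ (inst A φ θ ∨ᶠ inst A θ ψ))

NonTrivial : (L : Formula → Set) → Formula → Set
NonTrivial L A = L (¬ᶠ A) → Empty

{-# OPTIONS --safe #-}
module Submission where

-- Write ⊤ for ⊥ → ⊥. Every instance of P # Q at truth values is decided in
-- IPC, in particular ⊤ # ⊥. If ¬(⊤ # ⊥) holds, irreflexivity and symmetry
-- refute all four instances a # b with a, b ∈ {⊤, ⊥}; since ⊥ may be proved
-- by cases on P ∨ ¬P and Q ∨ ¬Q, this gives ¬(P # Q), so # is trivial.
-- If ⊤ # ⊥ holds, cotransitivity gives ⊤ # θ ∨ θ # ⊥ for every θ, and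
-- irreflexivity turns ⊤ # θ into ¬θ and θ # ⊥ into ¬¬θ. Hence θ # ⊥ ↔ ¬¬θ
-- and ¬θ ∨ ¬¬θ; casing on ¬P ∨ ¬¬P and ¬Q ∨ ¬¬Q yields P # Q ↔ ¬(P ↔ Q).
-- Uniqueness follows, as every non-trivial apartness is equivalent to ¬(P ↔ Q).

open import Defs
open import Data.Bool using (Bool; true; false)
open import Data.Empty using (⊥-elim)
open import Data.List using (List; []; _∷_)
open import Data.List.Membership.Propositional using (_∈_)
open import Data.List.Relation.Binary.Subset.Propositional using (_⊆_)
open import Data.List.Relation.Binary.Subset.Propositional.Properties using (∷⁺ʳ)
open import Data.List.Relation.Unary.Any using (here; there)
open import Data.Product using (_×_; _,_)
open import Data.Sum using (_⊎_; inj₁; inj₂)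
open import Relation.Binary.PropositionalEquality using (_≡_; refl; cong₂)
  renaming (subst to transport)

inst-PQ : ∀ {A} → InPQ A → inst A P Q ≡ A
inst-PQ v-P       = refl
inst-PQ v-Q       = refl
inst-PQ c-⊥       = refl
inst-PQ (c-∧ a b) = cong₂ _∧ᶠ_ (inst-PQ a) (inst-PQ b)
inst-PQ (c-∨ a b) = cong₂ _∨ᶠ_ (inst-PQ a) (inst-PQ b)
inst-PQ (c-⇒ a b) = cong₂ _⇒_ (inst-PQ a) (inst-PQ b)

⊤ᶠ : Formula
⊤ᶠ = ⊥ᶠ ⇒ ⊥ᶠ

truthValue : Bool → Formula
truthValue true  = ⊤ᶠ
truthValue false = ⊥ᶠ

literal : Bool → Formula → Formula
literal true  X = X
literal false X = ¬ᶠ X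

Context : Set
Context = List Formula

-- The most recent hypothesis is the innermost premise: [A₁, A₂] ⟹ φ is A₂ ⇒ A₁ ⇒ φ.
_⟹_ : Context → Formula → Formula
[]      ⟹ φ = φ
(A ∷ Γ) ⟹ φ = Γ ⟹ (A ⇒ φ)

module Derivations (L : Formula → Set) (SI : Superintuitionistic L) where
  open Superintuitionistic SI

  infix 1 _⊢_
  data _⊢_ (Γ : Context) : Formula → Set where
    hyp   : ∀ {A} → A ∈ Γ → Γ ⊢ A
    axiom : ∀ {A} → L A → Γ ⊢ A
    lam   : ∀ {A B} → A ∷ Γ ⊢ B → Γ ⊢ A ⇒ B
    app   : ∀ {A B} → Γ ⊢ A ⇒ B → Γ ⊢ A → Γ ⊢ B
    pair  : ∀ {A B} → Γ ⊢ A → Γ ⊢ B → Γ ⊢ A ∧ᶠ B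
    fst   : ∀ {A B} → Γ ⊢ A ∧ᶠ B → Γ ⊢ A
    snd   : ∀ {A B} → Γ ⊢ A ∧ᶠ B → Γ ⊢ B
    inl   : ∀ {A B} → Γ ⊢ A → Γ ⊢ A ∨ᶠ B
    inr   : ∀ {A B} → Γ ⊢ B → Γ ⊢ A ∨ᶠ B
    case  : ∀ {A B C} → Γ ⊢ A ∨ᶠ B → A ∷ Γ ⊢ C → B ∷ Γ ⊢ C → Γ ⊢ C
    abort : ∀ {A} → Γ ⊢ ⊥ᶠ → Γ ⊢ A

  L-identity : ∀ A → L (A ⇒ A)
  L-identity A = mp-cl (mp-cl (ipc⊆ (ax-S A (A ⇒ A) A)) (ipc⊆ (ax-K A (A ⇒ A))))
                       (ipc⊆ (ax-K A A))

  -- L (Γ ⟹ _) is an applicative functor, by the combinators K and S.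
  ⟹-pure : ∀ Γ {X} → L X → L (Γ ⟹ X)
  ⟹-ap   : ∀ Γ {X Y} → L (Γ ⟹ (X ⇒ Y)) → L (Γ ⟹ X) → L (Γ ⟹ Y)
  ⟹-map  : ∀ Γ {X Y} → L (X ⇒ Y) → L (Γ ⟹ X) → L (Γ ⟹ Y)
  ⟹-pure []      x = x
  ⟹-pure (A ∷ Γ) x = ⟹-pure Γ (mp-cl (ipc⊆ (ax-K _ A)) x)
  ⟹-ap []      f x = mp-cl f x
  ⟹-ap (A ∷ Γ) f x = ⟹-ap Γ (⟹-map Γ (ipc⊆ (ax-S A _ _)) f) x
  ⟹-map Γ g x = ⟹-ap Γ (⟹-pure Γ g) x

  ⟹-hyp : ∀ {Γ A} → A ∈ Γ → L (Γ ⟹ A)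
  ⟹-hyp {A ∷ Γ} (here refl) = ⟹-pure Γ (L-identity A)
  ⟹-hyp {B ∷ Γ} (there x)   = ⟹-map Γ (ipc⊆ (ax-K _ B)) (⟹-hyp x)

  sound : ∀ {Γ A} → Γ ⊢ A → L (Γ ⟹ A)
  sound     (hyp x)      = ⟹-hyp x
  sound {Γ} (axiom x)    = ⟹-pure Γ x
  sound     (lam d)      = sound d
  sound {Γ} (app d e)    = ⟹-ap Γ (sound d) (sound e)
  sound {Γ} (pair d e)   = ⟹-ap Γ (⟹-map Γ (ipc⊆ (ax-∧i _ _)) (sound d)) (sound e)
  sound {Γ} (fst d)      = ⟹-map Γ (ipc⊆ (ax-∧₁ _ _)) (sound d)
  sound {Γ} (snd d)      = ⟹-map Γ (ipc⊆ (ax-∧₂ _ _)) (sound d)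
  sound {Γ} (inl d)      = ⟹-map Γ (ipc⊆ (ax-∨₁ _ _)) (sound d)
  sound {Γ} (inr d)      = ⟹-map Γ (ipc⊆ (ax-∨₂ _ _)) (sound d)
  sound {Γ} (case d e f) =
    ⟹-ap Γ (⟹-ap Γ (⟹-map Γ (ipc⊆ (ax-∨e _ _ _)) (sound e)) (sound f)) (sound d)
  sound {Γ} (abort d)    = ⟹-map Γ (ipc⊆ (ax-⊥ _)) (sound d)

  weaken : ∀ {Γ Δ A} → Γ ⊆ Δ → Γ ⊢ A → Δ ⊢ A
  weaken ρ (hyp x)      = hyp (ρ x)
  weaken ρ (axiom x)    = axiom x
  weaken ρ (lam d)      = lam (weaken (∷⁺ʳ _ ρ) d)
  weaken ρ (app d e)    = app (weaken ρ d) (weaken ρ e)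
  weaken ρ (pair d e)   = pair (weaken ρ d) (weaken ρ e)
  weaken ρ (fst d)      = fst (weaken ρ d)
  weaken ρ (snd d)      = snd (weaken ρ d)
  weaken ρ (inl d)      = inl (weaken ρ d)
  weaken ρ (inr d)      = inr (weaken ρ d)
  weaken ρ (case d e f) = case (weaken ρ d) (weaken (∷⁺ʳ _ ρ) e) (weaken (∷⁺ʳ _ ρ) f)
  weaken ρ (abort d)    = abort (weaken ρ d)

  wk : ∀ {Γ A B} → Γ ⊢ A → B ∷ Γ ⊢ A
  wk = weaken there

  v0 : ∀ {Γ A} → A ∷ Γ ⊢ A
  v0 = hyp (here refl)

  v1 : ∀ {Γ A B} → B ∷ A ∷ Γ ⊢ A
  v1 = wk v0

  v2 : ∀ {Γ A B C} → C ∷ B ∷ A ∷ Γ ⊢ A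
  v2 = wk v1

  ⇔-intro : ∀ {Γ X Y} → X ∷ Γ ⊢ Y → Y ∷ Γ ⊢ X → Γ ⊢ X ⇔ᶠ Y
  ⇔-intro d e = pair (lam d) (lam e)

  to : ∀ {Γ X Y} → Γ ⊢ X ⇔ᶠ Y → Γ ⊢ X → Γ ⊢ Y
  to e = app (fst e)

  from : ∀ {Γ X Y} → Γ ⊢ X ⇔ᶠ Y → Γ ⊢ Y → Γ ⊢ X
  from e = app (snd e)

  ⇔-refl : ∀ {Γ X} → Γ ⊢ X ⇔ᶠ X
  ⇔-refl = ⇔-intro v0 v0

  ⇔-sym : ∀ {Γ X Y} → Γ ⊢ X ⇔ᶠ Y → Γ ⊢ Y ⇔ᶠ X
  ⇔-sym e = pair (snd e) (fst e)

  ⇔-trans : ∀ {Γ X Y Z} → Γ ⊢ X ⇔ᶠ Y → Γ ⊢ Y ⇔ᶠ Z → Γ ⊢ X ⇔ᶠ Z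
  ⇔-trans e f = ⇔-intro (to (wk f) (to (wk e) v0)) (from (wk e) (from (wk f) v0))

  ¬-both⇒⇔ : ∀ {Γ X Y} → Γ ⊢ ¬ᶠ X → Γ ⊢ ¬ᶠ Y → Γ ⊢ X ⇔ᶠ Y
  ¬-both⇒⇔ nx ny = ⇔-intro (abort (app (wk nx) v0)) (abort (app (wk ny) v0))

  ¬¬-both⇒¬¬⇔ : ∀ {Γ X Y} → Γ ⊢ ¬ᶠ ¬ᶠ X → Γ ⊢ ¬ᶠ ¬ᶠ Y → Γ ⊢ ¬ᶠ ¬ᶠ (X ⇔ᶠ Y)
  ¬¬-both⇒¬¬⇔ nnx nny =
    lam (app (wk nny) (lam (app (wk (wk nnx)) (lam (app v2 (⇔-intro v2 v1))))))

  inst-cong : ∀ {Γ F X X′ Y Y′} → InPQ F → Γ ⊢ X ⇔ᶠ X′ → Γ ⊢ Y ⇔ᶠ Y′ →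
              Γ ⊢ inst F X Y ⇔ᶠ inst F X′ Y′
  inst-cong v-P ex ey = ex
  inst-cong v-Q ex ey = ey
  inst-cong c-⊥ ex ey = ⇔-refl
  inst-cong (c-∧ f g) ex ey =
    let a = inst-cong f ex ey ; b = inst-cong g ex ey in
    ⇔-intro (pair (to (wk a) (fst v0)) (to (wk b) (snd v0)))
            (pair (from (wk a) (fst v0)) (from (wk b) (snd v0)))
  inst-cong (c-∨ f g) ex ey =
    let a = inst-cong f ex ey ; b = inst-cong g ex ey in
    ⇔-intro (case v0 (inl (to (wk (wk a)) v0)) (inr (to (wk (wk b)) v0)))
            (case v0 (inl (from (wk (wk a)) v0)) (inr (from (wk (wk b)) v0)))
  inst-cong (c-⇒ f g) ex ey =
    let a = inst-cong f ex ey ; b = inst-cong g ex ey in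
    ⇔-intro (lam (to (wk (wk b)) (app v1 (from (wk (wk a)) v0))))
            (lam (from (wk (wk b)) (app v1 (to (wk (wk a)) v0))))

  literal⇒⇔truthValue : ∀ b {Γ X} → Γ ⊢ literal b X → Γ ⊢ X ⇔ᶠ truthValue b
  literal⇒⇔truthValue true  d = ⇔-intro (lam v0) (wk d)
  literal⇒⇔truthValue false d = ⇔-intro (app (wk d) v0) (abort v0)

  -- ¬¬(X ∨ ¬X) is intuitionistic, so excluded middle is available when proving ⊥.
  ⊥-by-excluded-middle : ∀ {Γ} X → ((b : Bool) → literal b X ∷ Γ ⊢ ⊥ᶠ) → Γ ⊢ ⊥ᶠ
  ⊥-by-excluded-middle X k = app (lam (k false)) (lam (k true))

  decide-at-truthValues : ∀ {Γ F} → InPQ F → ∀ a b →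
    (Γ ⊢ inst F (truthValue a) (truthValue b)) ⊎
    (Γ ⊢ ¬ᶠ inst F (truthValue a) (truthValue b))
  decide-at-truthValues v-P true  b     = inj₁ (lam v0)
  decide-at-truthValues v-P false b     = inj₂ (lam v0)
  decide-at-truthValues v-Q a     true  = inj₁ (lam v0)
  decide-at-truthValues v-Q a     false = inj₂ (lam v0)
  decide-at-truthValues c-⊥ a     b     = inj₂ (lam v0)
  decide-at-truthValues (c-∧ f g) a b
    with decide-at-truthValues f a b | decide-at-truthValues g a b
  ... | inj₁ x  | inj₁ y  = inj₁ (pair x y)
  ... | inj₂ nx | _       = inj₂ (lam (app (wk nx) (fst v0)))
  ... | inj₁ _  | inj₂ ny = inj₂ (lam (app (wk ny) (snd v0)))
  decide-at-truthValues (c-∨ f g) a b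
    with decide-at-truthValues f a b | decide-at-truthValues g a b
  ... | inj₁ x  | _       = inj₁ (inl x)
  ... | inj₂ _  | inj₁ y  = inj₁ (inr y)
  ... | inj₂ nx | inj₂ ny = inj₂ (lam (case v0 (app (wk (wk nx)) v0) (app (wk (wk ny)) v0)))
  decide-at-truthValues (c-⇒ f g) a b
    with decide-at-truthValues f a b | decide-at-truthValues g a b
  ... | inj₂ nx | _       = inj₁ (lam (abort (app (wk nx) v0)))
  ... | inj₁ _  | inj₁ y  = inj₁ (lam (wk y))
  ... | inj₁ x  | inj₂ ny = inj₂ (lam (app (wk ny) (app v0 (wk x))))

  module ApartnessRelation {A : Formula} (inA : InPQ A) (ap : Apartness L A) where
    open Apartness ap

    infix 8 _#_
    _#_ : Formula → Formula → Formula
    _#_ = inst A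

    #-irrefl : ∀ {Γ} X → Γ ⊢ ¬ᶠ (X # X)
    #-irrefl X = axiom (irrefl X)

    #-sym : ∀ {Γ X Y} → Γ ⊢ X # Y → Γ ⊢ Y # X
    #-sym {X = X} {Y} = app (axiom (symm X Y))

    #-cotrans : ∀ {Γ X Y} θ → Γ ⊢ X # Y → Γ ⊢ X # θ ∨ᶠ θ # Y
    #-cotrans {X = X} {Y} θ = app (axiom (cotrans X Y θ))

    #-resp-⇔ : ∀ {Γ X X′ Y Y′} → Γ ⊢ X ⇔ᶠ X′ → Γ ⊢ Y ⇔ᶠ Y′ → Γ ⊢ X # Y → Γ ⊢ X′ # Y′
    #-resp-⇔ ex ey = to (inst-cong inA ex ey)

    #⇒¬⇔ : ∀ {Γ X Y} → Γ ⊢ X # Y → Γ ⊢ ¬ᶠ (X ⇔ᶠ Y)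
    #⇒¬⇔ {X = X} d = lam (app (#-irrefl X) (#-resp-⇔ ⇔-refl (⇔-sym v0) (wk d)))

    refuted-at-truthValues⇒trivial : L (¬ᶠ (⊤ᶠ # ⊥ᶠ)) → L (¬ᶠ A)
    refuted-at-truthValues⇒trivial ¬⊤#⊥ =
      transport (λ Z → L (¬ᶠ Z)) (inst-PQ inA) (sound {[]} (lam
        (⊥-by-excluded-middle P λ a → ⊥-by-excluded-middle Q λ b →
          app (refuted a b)
              (#-resp-⇔ (literal⇒⇔truthValue a v1) (literal⇒⇔truthValue b v0) v2))))
      where
      refuted : ∀ {Γ} a b → Γ ⊢ ¬ᶠ (truthValue a # truthValue b)
      refuted true  true  = #-irrefl ⊤ᶠ
      refuted false false = #-irrefl ⊥ᶠ
      refuted true  false = axiom ¬⊤#⊥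
      refuted false true  = lam (app (axiom ¬⊤#⊥) (#-sym v0))

    module TruthValuesApart (⊤#⊥ : L (⊤ᶠ # ⊥ᶠ)) where

      ⊤#⇒¬ : ∀ {Γ θ} → Γ ⊢ ⊤ᶠ # θ → Γ ⊢ ¬ᶠ θ
      ⊤#⇒¬ d = lam (app (#-irrefl ⊤ᶠ)
        (#-resp-⇔ ⇔-refl (literal⇒⇔truthValue true v0) (wk d)))

      #⊥⇒¬¬ : ∀ {Γ θ} → Γ ⊢ θ # ⊥ᶠ → Γ ⊢ ¬ᶠ ¬ᶠ θ
      #⊥⇒¬¬ d = lam (app (#-irrefl ⊥ᶠ)
        (#-resp-⇔ (literal⇒⇔truthValue false v0) ⇔-refl (wk d)))

      ⊤#∨#⊥ : ∀ {Γ} θ → Γ ⊢ ⊤ᶠ # θ ∨ᶠ θ # ⊥ᶠ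
      ⊤#∨#⊥ θ = #-cotrans θ (axiom ⊤#⊥)

      weak-excluded-middle : ∀ {Γ} θ → Γ ⊢ ¬ᶠ θ ∨ᶠ ¬ᶠ ¬ᶠ θ
      weak-excluded-middle θ = case (⊤#∨#⊥ θ) (inl (⊤#⇒¬ v0)) (inr (#⊥⇒¬¬ v0))

      ¬¬⇒#⊥ : ∀ {Γ θ} → Γ ⊢ ¬ᶠ ¬ᶠ θ → Γ ⊢ θ # ⊥ᶠ
      ¬¬⇒#⊥ {θ = θ} d = case (⊤#∨#⊥ θ) (abort (app (wk d) (⊤#⇒¬ v0))) v0

      ¬⇔⇒# : ∀ {Γ} → Γ ⊢ ¬ᶠ (P ⇔ᶠ Q) → Γ ⊢ P # Q
      ¬⇔⇒# ne = case (weak-excluded-middle P)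
        (case (weak-excluded-middle Q)
          (abort (app (wk (wk ne)) (¬-both⇒⇔ v1 v0)))
          (#-resp-⇔ (⇔-sym (literal⇒⇔truthValue false v1)) ⇔-refl (#-sym (¬¬⇒#⊥ v0))))
        (case (weak-excluded-middle Q)
          (#-resp-⇔ ⇔-refl (⇔-sym (literal⇒⇔truthValue false v0)) (¬¬⇒#⊥ v1))
          (abort (app (¬¬-both⇒¬¬⇔ v1 v0) (wk (wk ne)))))

      #⇔¬⇔ : L (A ⇔ᶠ ¬ᶠ (P ⇔ᶠ Q))
      #⇔¬⇔ = transport (λ Z → L (Z ⇔ᶠ ¬ᶠ (P ⇔ᶠ Q))) (inst-PQ inA)
        (sound {[]} (⇔-intro (#⇒¬⇔ v0) (¬⇔⇒# v0)))

    nonTrivial⇒#⇔¬⇔ : NonTrivial L A → L (A ⇔ᶠ ¬ᶠ (P ⇔ᶠ Q))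
    nonTrivial⇒#⇔¬⇔ nt with decide-at-truthValues {[]} inA true false
    ... | inj₁ ⊤#⊥  = TruthValuesApart.#⇔¬⇔ (sound ⊤#⊥)
    ... | inj₂ ¬⊤#⊥ = ⊥-elim (nt (refuted-at-truthValues⇒trivial (sound ¬⊤#⊥)))

mainTheorem13 : (L : Formula → Set) → Superintuitionistic L →
    ((A B : Formula) → InPQ A → InPQ B →
      Apartness L A → NonTrivial L A →
      Apartness L B → NonTrivial L B →
      L (A ⇔ᶠ B))
    ×
    ((A : Formula) → InPQ A → Apartness L A → NonTrivial L A →
      L (A ⇔ᶠ ¬ᶠ (P ⇔ᶠ Q)))
mainTheorem13 L SI = unique , characterisation
  where
  open Derivations L SI

  characterisation : (A : Formula) → InPQ A → Apartness L A → NonTrivial L A →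
                     L (A ⇔ᶠ ¬ᶠ (P ⇔ᶠ Q))
  characterisation A inA ap = ApartnessRelation.nonTrivial⇒#⇔¬⇔ inA ap

  unique : (A B : Formula) → InPQ A → InPQ B → Apartness L A → NonTrivial L A →
           Apartness L B → NonTrivial L B → L (A ⇔ᶠ B)
  unique A B inA inB apA ntA apB ntB = sound {[]}
    (⇔-trans (axiom (characterisation A inA apA ntA))
             (⇔-sym (axiom (characterisation B inB apB ntB))))
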